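{- Let $Av=b$ be a linear system over $\mathbb{F}_2$ in the variables $v=(x_{ij})\cup(z_{ikj})$ of $\mathrm{DLO}_n$ with at most $n-3$ equations that has a $\mathrm{WORDER}_n$-proper solution $\sigma$ with $\sigma(z_{ikj})=0$ for all $z_{ikj}$. Then for every density clause $D_{st}$ there is a $\mathrm{WORDER}_n$-proper solution $\tau$ of $Av=b$ that satisfies $D_{st}$ and such that $\tau(z_{ikj})=1$ only if $i=s$ and $j=t$.
   Context: $\mathrm{DLO}_n$ is the CNF in the variables $(x_{ij})_{i\ne j\in[n]}$ and $(z_{ikj})$ for distinct $i,k,j\in[n]$, consisting of: $\neg x_{ij}\lor\neg x_{ji}$ for $i\neq j$; $x_{ij}\lor x_{ji}$ for $i\ne j$; $\neg x_{ij}\lor\neg x_{jk}\lor x_{ik}$ for distinct $i,j,k$; $\neg z_{ikj}\lor x_{ik}$ and $\neg z_{ikj}\lor x_{kj}$ for distinct $i,j,k$; and the density clauses $D_{ij} = \neg x_{ij}\lor\bigvee_{k\in[n]\setminus\{i,j\}} z_{ikj}$ for $i\ne j$. $\mathrm{WORDER}_n$ is the set of all clauses of $\mathrm{DLO}_n$ other than the density clauses. A solution of a linear system is $\mathrm{WORDER}_n$-proper if it satisfies every clause of $\mathrm{WORDER}_n$. -}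

module Defs where

open import Data.Nat using (ℕ; zero; suc; _+_; _≤_)
open import Data.Fin using (Fin; zero; suc; _≟_)
open import Data.Bool using (Bool; true; false; _xor_; _∧_; not; if_then_else_)
open import Data.List using (List; length)
open import Data.List.Relation.Unary.All using (All)
open import Data.Product using (_×_; Σ; ∃-syntax)
open import Data.Sum using (_⊎_)
open import Relation.Nullary using (¬_)
open import Relation.Nullary.Decidable using (⌊_⌋)
open import Relation.Binary.PropositionalEquality using (_≡_; _≢_)

⊕[_] : ∀ {n} → (Fin n → Bool) → Bool
⊕[_] {zero}  f = false
⊕[_] {suc n} f = f zero xor ⊕[ (λ i → f (suc i)) ]

dist₂ : ∀ {n} → Fin n → Fin n → Bool
dist₂ i j = not ⌊ i ≟ j ⌋

dist₃ : ∀ {n} → Fin n → Fin n → Fin n → Bool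
dist₃ i k j = dist₂ i k ∧ dist₂ k j ∧ dist₂ i j

-- An assignment to the variables of DLO_n:  x i j  is x_{ij},  z i k j  is z_{ikj}.
-- Values at non-distinct indices are not variables and are ignored everywhere.
record Assignment (n : ℕ) : Set where
  field
    x : Fin n → Fin n → Bool
    z : Fin n → Fin n → Fin n → Bool
open Assignment public

-- Coefficients at non-distinct indices are ignored (they are not variables).
record Equation (n : ℕ) : Set where
  field
    cx  : Fin n → Fin n → Bool
    cz  : Fin n → Fin n → Fin n → Bool
    rhs : Bool
open Equation public

lhs : ∀ {n} → Equation n → Assignment n → Bool
lhs e σ =
  ⊕[ (λ i → ⊕[ (λ j → dist₂ i j ∧ (cx e i j ∧ x σ i j)) ]) ]
  xor
  ⊕[ (λ i → ⊕[ (λ k → ⊕[ (λ j → dist₃ i k j ∧ (cz e i k j ∧ z σ i k j)) ]) ]) ]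

LinSystem : ℕ → Set
LinSystem n = List (Equation n)

Solves : ∀ {n} → Assignment n → LinSystem n → Set
Solves σ A = All (λ e → lhs e σ ≡ rhs e) A

record WORDER-proper {n : ℕ} (σ : Assignment n) : Set where
  field
    antisym : ∀ i j → i ≢ j → x σ i j ≡ false ⊎ x σ j i ≡ false
    total   : ∀ i j → i ≢ j → x σ i j ≡ true ⊎ x σ j i ≡ true
    trans   : ∀ i j k → i ≢ j → j ≢ k → i ≢ k →
              x σ i j ≡ false ⊎ (x σ j k ≡ false ⊎ x σ i k ≡ true)
    zleft   : ∀ i k j → i ≢ k → k ≢ j → i ≢ j → z σ i k j ≡ false ⊎ x σ i k ≡ true
    zright  : ∀ i k j → i ≢ k → k ≢ j → i ≢ j → z σ i k j ≡ false ⊎ x σ k j ≡ true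

SatDensity : ∀ {n} → Assignment n → Fin n → Fin n → Set
SatDensity σ s t = x σ s t ≡ false ⊎ (∃[ k ] (k ≢ s × k ≢ t × z σ s k t ≡ true))

{-# OPTIONS --safe #-}
-- If x_st is false, σ itself satisfies D_st.  Otherwise, for c ∈ F₂ⁿ supported outside {s, t},
-- let τ_c move every k with c_k = 1 into the interval between s and t: elements below s go just
-- above s, elements above t just below t, each moved block in reversed σ-order, and z_skt := c_k.
-- Because of the reversal, every x_ij of τ_c is x_ij of σ plus c_i, c_j or 0, so A τ_c = A σ + L c
-- for a linear L with at most n − 3 rows; as c ranges over n − 2 coordinates, some c ≠ 0 has
-- L c = 0, and any k with c_k = 1 witnesses D_st.
module Submission where

open import Defs
open import Algebra.Bundles using (CommutativeRing)
open import Data.Bool using (Bool; true; false; _xor_; _∧_; not; if_then_else_; T)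
open import Data.Bool.Properties
  using (xor-∧-commutativeRing; xor-same; xor-identityʳ; ∧-zeroʳ; ∧-identityʳ; ∧-distribˡ-xor; ∧-distribʳ-xor; ¬-not; not-involutive)
  renaming (_≟_ to _≟ᵇ_)
open import Data.Fin using (Fin; zero; suc; _≟_; punchIn)
open import Data.Fin.Properties using (punchInᵢ≢i; any?)
open import Data.List using (List; []; _∷_; length)
open import Data.List.Relation.Unary.All as All using (All; []; _∷_)
open import Data.Nat using (ℕ; zero; suc; _+_; _<_; _≤_; _<ᵇ_; s≤s⁻¹)
open import Data.Nat.Properties using (+-0-commutativeMonoid; +-comm; <-cmp; <-irrefl; <-asym; <-trans; n<1+n; <ᵇ⇒<)
open import Data.Product using (Σ; _×_; _,_; proj₁; proj₂; ∃-syntax)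
open import Data.Sum using (_⊎_; inj₁; inj₂)
open import Data.Unit using (tt)
open import Function using (_∘_)
open import Relation.Binary.Definitions using (tri<; tri≈; tri>)
open import Relation.Nullary using (Dec; yes; no; ¬_; contradiction)
open import Relation.Nullary.Decidable using (⌊_⌋; isYes≗does; dec-true; dec-false; map′; _×-dec_; from-yes)
open import Relation.Binary.PropositionalEquality
  using (_≡_; _≢_; _≗_; ≢-sym; refl; sym; trans; cong; cong₂; subst; subst₂; module ≡-Reasoning)

open CommutativeRing xor-∧-commutativeRing using (+-commutativeMonoid; +-commutativeSemigroup)
open import Algebra.Properties.CommutativeSemigroup +-commutativeSemigroup using (interchange)
open import Algebra.Properties.CommutativeMonoid.Sum +-commutativeMonoid
  using (sum; sum-cong-≗; ∑-distrib-+; sum-remove; sum-replicate-zero)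
import Algebra.Properties.CommutativeMonoid.Sum +-0-commutativeMonoid as ℕ-Sum

isYes-true : ∀ {a} {A : Set a} (a? : Dec A) → A → ⌊ a? ⌋ ≡ true
isYes-true a? a = trans (isYes≗does a?) (dec-true a? a)

isYes-false : ∀ {a} {A : Set a} (a? : Dec A) → ¬ A → ⌊ a? ⌋ ≡ false
isYes-false a? ¬a = trans (isYes≗does a?) (dec-false a? ¬a)

isYes-sound : ∀ {a} {A : Set a} (a? : Dec A) → ⌊ a? ⌋ ≡ true → A
isYes-sound (yes a) _ = a

⊕≡sum : ∀ {n} (f : Fin n → Bool) → ⊕[ f ] ≡ sum f
⊕≡sum {zero}  f = refl
⊕≡sum {suc n} f = cong (f zero xor_) (⊕≡sum (f ∘ suc))

⊕-cong : ∀ {n} {f g : Fin n → Bool} → f ≗ g → ⊕[ f ] ≡ ⊕[ g ]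
⊕-cong {f = f} {g} f≗g = trans (⊕≡sum f) (trans (sum-cong-≗ f≗g) (sym (⊕≡sum g)))

⊕-distrib-xor : ∀ {n} (f g : Fin n → Bool) → ⊕[ (λ i → f i xor g i) ] ≡ ⊕[ f ] xor ⊕[ g ]
⊕-distrib-xor f g = begin
  ⊕[ (λ i → f i xor g i) ] ≡⟨ ⊕≡sum (λ i → f i xor g i) ⟩
  sum (λ i → f i xor g i)  ≡⟨ ∑-distrib-+ f g ⟩
  sum f xor sum g          ≡⟨ sym (cong₂ _xor_ (⊕≡sum f) (⊕≡sum g)) ⟩
  ⊕[ f ] xor ⊕[ g ]        ∎
  where open ≡-Reasoning

⊕-false : ∀ {n} {f : Fin n → Bool} → (∀ i → f i ≡ false) → ⊕[ f ] ≡ false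
⊕-false {n} f≡false = trans (⊕-cong f≡false) (trans (⊕≡sum {n} (λ _ → false)) (sum-replicate-zero n))

⊕-select : ∀ {n} (c : Fin n → Bool) (k : Fin n) → ⊕[ (λ i → c i ∧ ⌊ i ≟ k ⌋) ] ≡ c k
⊕-select {suc n} c k = begin
  ⊕[ term ]                                   ≡⟨ ⊕≡sum term ⟩
  sum term                                    ≡⟨ sum-remove term ⟩
  term k xor sum (term ∘ punchIn k)           ≡⟨ cong₂ _xor_ (cong (c k ∧_) (isYes-true (k ≟ k) refl)) (sum-cong-≗ {n} off-k) ⟩
  (c k ∧ true) xor sum {n} (λ _ → false)      ≡⟨ cong₂ _xor_ (∧-identityʳ (c k)) (sum-replicate-zero n) ⟩
  c k xor false                               ≡⟨ xor-identityʳ (c k) ⟩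
  c k                                         ∎
  where
  open ≡-Reasoning
  term : Fin (suc n) → Bool
  term i = c i ∧ ⌊ i ≟ k ⌋
  off-k : term ∘ punchIn k ≗ (λ _ → false)
  off-k i = trans (cong (c (punchIn k i) ∧_) (isYes-false (punchIn k i ≟ k) (punchInᵢ≢i k i))) (∧-zeroʳ _)

Bits : ℕ → Set
Bits n = Fin n → Bool

infixl 6 _⊕_
infix 4 _⊆_

_⊕_ : ∀ {n} → Bits n → Bits n → Bits n
(c ⊕ d) k = c k xor d k

unit : ∀ {n} → Fin n → Bits n
unit p k = ⌊ p ≟ k ⌋

_⊆_ : ∀ {n} → Bits n → Bits n → Set
c ⊆ Q = ∀ k → c k ≡ true → Q k ≡ true

Nonzero : ∀ {n} → Bits n → Set
Nonzero c = ∃[ k ] c k ≡ true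

_-_ : ∀ {n} → Bits n → Fin n → Bits n
(Q - p) k = Q k ∧ not ⌊ k ≟ p ⌋

record Linear {n} (Λ : Bits n → Bool) : Set where
  field
    additive : ∀ c d → Λ (c ⊕ d) ≡ Λ c xor Λ d
    resp-≗   : ∀ {c d} → c ≗ d → Λ c ≡ Λ d

module _ {n} {Λ : Bits n → Bool} (lin : Linear Λ) where
  open Linear lin

  linear-zero : Λ (λ _ → false) ≡ false
  linear-zero = trans (additive (λ _ → false) (λ _ → false)) (xor-same (Λ (λ _ → false)))

  linear-scale : ∀ b c → Λ (λ k → b ∧ c k) ≡ b ∧ Λ c
  linear-scale true  c = refl
  linear-scale false c = linear-zero

  linear-⊕ : ∀ {m} (f : Fin m → Bits n) → Λ (λ k → ⊕[ (λ i → f i k) ]) ≡ ⊕[ (λ i → Λ (f i)) ]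
  linear-⊕ {zero}  f = linear-zero
  linear-⊕ {suc m} f = trans (additive (f zero) _) (cong (Λ (f zero) xor_) (linear-⊕ (f ∘ suc)))

  linear-vanishes : ∀ {c} → (∀ k → c k ≡ true → Λ (unit k) ≡ false) → Λ c ≡ false
  linear-vanishes {c} Λunit≡false = begin
    Λ c                                    ≡⟨ resp-≗ (λ k → sym (⊕-select c k)) ⟩
    Λ (λ k → ⊕[ (λ i → c i ∧ unit i k) ]) ≡⟨ linear-⊕ (λ i k → c i ∧ unit i k) ⟩
    ⊕[ (λ i → Λ (λ k → c i ∧ unit i k)) ] ≡⟨ ⊕-false (λ i → trans (linear-scale (c i) (unit i)) (term i (c i) refl)) ⟩
    false                                  ∎
    where
    open ≡-Reasoning
    term : ∀ i b → c i ≡ b → b ∧ Λ (unit i) ≡ false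
    term i true  ci = Λunit≡false i ci
    term i false _  = refl

𝟙 : Bool → ℕ
𝟙 b = if b then 1 else 0

count : ∀ {n} → Bits n → ℕ
count Q = ℕ-Sum.sum (𝟙 ∘ Q)

count-all : ∀ n → count {n} (λ _ → true) ≡ n
count-all zero    = refl
count-all (suc n) = cong suc (count-all n)

remove-at : ∀ {n} (Q : Bits n) p → (Q - p) p ≡ false
remove-at Q p = trans (cong (λ b → Q p ∧ not b) (isYes-true (p ≟ p) refl)) (∧-zeroʳ (Q p))

remove-off : ∀ {n} (Q : Bits n) {p k} → k ≢ p → (Q - p) k ≡ Q k
remove-off Q {p} {k} k≢p = trans (cong (λ b → Q k ∧ not b) (isYes-false (k ≟ p) k≢p)) (∧-identityʳ (Q k))

remove⁻ : ∀ {n} (Q : Bits n) {p k} → (Q - p) k ≡ true → Q k ≡ true × k ≢ p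
remove⁻ Q {p} {k} Qk∧k≢p with Q k | k ≟ p
... | true | no k≢p = refl , k≢p

count-remove : ∀ {n} (Q : Bits n) {p} → Q p ≡ true → count Q ≡ suc (count (Q - p))
count-remove {suc n} Q {p} Qp = begin
  count Q                                                       ≡⟨ ℕ-Sum.sum-remove (𝟙 ∘ Q) ⟩
  𝟙 (Q p) + ℕ-Sum.sum (𝟙 ∘ Q ∘ punchIn p)                      ≡⟨ cong₂ _+_ (cong 𝟙 Qp) (ℕ-Sum.sum-cong-≗ {n} off-p) ⟩
  suc (ℕ-Sum.sum (𝟙 ∘ (Q - p) ∘ punchIn p))                    ≡⟨ cong (λ b → suc (𝟙 b + ℕ-Sum.sum (𝟙 ∘ (Q - p) ∘ punchIn p))) (remove-at Q p) ⟨
  suc (𝟙 ((Q - p) p) + ℕ-Sum.sum (𝟙 ∘ (Q - p) ∘ punchIn p))   ≡⟨ cong suc (ℕ-Sum.sum-remove (𝟙 ∘ (Q - p))) ⟨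
  suc (count (Q - p))                                           ∎
  where
  open ≡-Reasoning
  off-p : 𝟙 ∘ Q ∘ punchIn p ≗ 𝟙 ∘ (Q - p) ∘ punchIn p
  off-p i = cong 𝟙 (sym (remove-off Q (punchInᵢ≢i p i)))

count-positive : ∀ {n} (Q : Bits n) → 0 < count Q → Nonzero Q
count-positive {suc n} Q 0<count with Q zero in Q0
... | true  = zero , Q0
... | false with count-positive (Q ∘ suc) 0<count
...   | k , Qk = suc k , Qk

module _ {n} (Λ : Bits n → Bool) (p : Fin n) where

  eliminate : Bits n → Bits n
  eliminate c = c ⊕ (λ k → Λ c ∧ unit p k)

  eliminate-off : ∀ c {k} → k ≢ p → eliminate c k ≡ c k
  eliminate-off c {k} k≢p = begin
    c k xor (Λ c ∧ ⌊ p ≟ k ⌋) ≡⟨ cong (λ b → c k xor (Λ c ∧ b)) (isYes-false (p ≟ k) (λ p≡k → k≢p (sym p≡k))) ⟩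
    c k xor (Λ c ∧ false)     ≡⟨ cong (c k xor_) (∧-zeroʳ (Λ c)) ⟩
    c k xor false             ≡⟨ xor-identityʳ (c k) ⟩
    c k                       ∎
    where open ≡-Reasoning

  module _ (lin : Linear Λ) where
    open Linear lin

    eliminate-kills : Λ (unit p) ≡ true → ∀ c → Λ (eliminate c) ≡ false
    eliminate-kills Λp≡true c = begin
      Λ (eliminate c)                        ≡⟨ additive c _ ⟩
      Λ c xor Λ (λ k → Λ c ∧ unit p k)       ≡⟨ cong (Λ c xor_) (linear-scale lin (Λ c) (unit p)) ⟩
      Λ c xor (Λ c ∧ Λ (unit p))             ≡⟨ cong (λ b → Λ c xor (Λ c ∧ b)) Λp≡true ⟩
      Λ c xor (Λ c ∧ true)                   ≡⟨ cong (Λ c xor_) (∧-identityʳ (Λ c)) ⟩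
      Λ c xor Λ c                            ≡⟨ xor-same (Λ c) ⟩
      false                                  ∎
      where open ≡-Reasoning

    eliminate-linear : ∀ {Λ'} → Linear Λ' → Linear (Λ' ∘ eliminate)
    eliminate-linear lin' = record
      { additive = λ c d → trans (resp-≗' (eliminate-⊕ c d)) (additive' (eliminate c) (eliminate d))
      ; resp-≗   = λ c≗d → resp-≗' (λ k → cong₂ (λ a b → a xor (b ∧ unit p k)) (c≗d k) (resp-≗ c≗d))
      }
      where
      open Linear lin' renaming (additive to additive'; resp-≗ to resp-≗')
      eliminate-⊕ : ∀ c d → eliminate (c ⊕ d) ≗ eliminate c ⊕ eliminate d
      eliminate-⊕ c d k = begin
        (c k xor d k) xor (Λ (c ⊕ d) ∧ unit p k)                 ≡⟨ cong (λ b → (c k xor d k) xor (b ∧ unit p k)) (additive c d) ⟩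
        (c k xor d k) xor ((Λ c xor Λ d) ∧ unit p k)             ≡⟨ cong ((c k xor d k) xor_) (∧-distribʳ-xor (unit p k) (Λ c) (Λ d)) ⟩
        (c k xor d k) xor ((Λ c ∧ unit p k) xor (Λ d ∧ unit p k)) ≡⟨ interchange (c k) (d k) _ _ ⟩
        (c k xor (Λ c ∧ unit p k)) xor (d k xor (Λ d ∧ unit p k)) ∎
        where open ≡-Reasoning

-- Gaussian elimination: a pivot p ∈ Q of the first functional is solved for, removing p from Q.
common-zero : ∀ {n} {I : Set} (Λ : I → Bits n → Bool) → (∀ i → Linear (Λ i)) →
  (is : List I) (Q : Bits n) → length is < count Q →
  ∃[ c ] (Nonzero c × c ⊆ Q × All (λ i → Λ i c ≡ false) is)
common-zero Λ lin [] Q 0<count with count-positive Q 0<count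
... | k , Qk = unit k , (k , isYes-true (k ≟ k) refl) , (λ j ukj → subst (λ j → Q j ≡ true) (isYes-sound (k ≟ j) ukj) Qk) , []
common-zero Λ lin (i ∷ is) Q len<count with any? (λ k → (Q k ≟ᵇ true) ×-dec (Λ i (unit k) ≟ᵇ true))
... | no no-pivot with common-zero Λ lin is Q (<-trans (n<1+n _) len<count)
...   | c , c≢0 , c⊆Q , ker = c , c≢0 , c⊆Q , Λic≡false ∷ ker
  where
  Λic≡false : Λ i c ≡ false
  Λic≡false = linear-vanishes (lin i) (λ k ck → ¬-not (λ Λik → no-pivot (k , c⊆Q k ck , Λik)))
common-zero {n} Λ lin (i ∷ is) Q len<count | yes (p , Qp , Λip) with
  common-zero (λ j → Λ j ∘ eliminate (Λ i) p) (λ j → eliminate-linear (Λ i) p (lin i) (lin j)) is (Q - p)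
              (s≤s⁻¹ (subst (suc (length is) <_) (count-remove Q Qp) len<count))
... | c , (k , ck) , c⊆Q-p , ker =
  eliminate (Λ i) p c , (k , trans (eliminate-off (Λ i) p c k≢p) ck) , eliminated⊆Q ,
  eliminate-kills (Λ i) p (lin i) Λip c ∷ ker
  where
  k≢p : k ≢ p
  k≢p = proj₂ (remove⁻ Q (c⊆Q-p k ck))
  eliminated⊆Q : eliminate (Λ i) p c ⊆ Q
  eliminated⊆Q j ej with j ≟ p
  ... | yes refl = Qp
  ... | no j≢p   = proj₁ (remove⁻ Q (c⊆Q-p j (trans (sym (eliminate-off (Λ i) p c j≢p)) ej)))

infixl 6 _⊕ₐ_
infix 4 _≐_

_⊕ₐ_ : ∀ {n} → Assignment n → Assignment n → Assignment n
x (σ ⊕ₐ δ) i j   = x σ i j xor x δ i j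
z (σ ⊕ₐ δ) i k j = z σ i k j xor z δ i k j

_≐_ : ∀ {n} → Assignment n → Assignment n → Set
ρ ≐ σ = (∀ {i j} → i ≢ j → x ρ i j ≡ x σ i j) ×
        (∀ {i k j} → i ≢ k → k ≢ j → i ≢ j → z ρ i k j ≡ z σ i k j)

dist₂-guard : ∀ {n} (i j : Fin n) {a b} → (i ≢ j → a ≡ b) → dist₂ i j ∧ a ≡ dist₂ i j ∧ b
dist₂-guard i j a≡b with i ≟ j
... | yes _   = refl
... | no i≢j  = a≡b i≢j

dist₃-guard : ∀ {n} (i k j : Fin n) {a b} → (i ≢ k → k ≢ j → i ≢ j → a ≡ b) → dist₃ i k j ∧ a ≡ dist₃ i k j ∧ b
dist₃-guard i k j a≡b with i ≟ k | k ≟ j | i ≟ j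
... | yes _  | _      | _      = refl
... | no _   | yes _  | _      = refl
... | no _   | no _   | yes _  = refl
... | no i≢k | no k≢j | no i≢j = a≡b i≢k k≢j i≢j

lhs-resp : ∀ {n} (e : Equation n) {ρ σ} → ρ ≐ σ → lhs e ρ ≡ lhs e σ
lhs-resp e (x≡ , z≡) = cong₂ _xor_
  (⊕-cong λ i → ⊕-cong λ j → dist₂-guard i j λ i≢j → cong (cx e i j ∧_) (x≡ i≢j))
  (⊕-cong λ i → ⊕-cong λ k → ⊕-cong λ j → dist₃-guard i k j λ i≢k k≢j i≢j → cong (cz e i k j ∧_) (z≡ i≢k k≢j i≢j))

∧∧-distribˡ-xor : ∀ a b c d → a ∧ (b ∧ (c xor d)) ≡ (a ∧ (b ∧ c)) xor (a ∧ (b ∧ d))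
∧∧-distribˡ-xor a b c d = trans (cong (a ∧_) (∧-distribˡ-xor b c d)) (∧-distribˡ-xor a _ _)

⊕²-distrib-xor : ∀ {n} (f g : Fin n → Fin n → Bool) →
  ⊕[ (λ i → ⊕[ (λ j → f i j xor g i j) ]) ] ≡ ⊕[ (λ i → ⊕[ f i ]) ] xor ⊕[ (λ i → ⊕[ g i ]) ]
⊕²-distrib-xor f g = trans (⊕-cong λ i → ⊕-distrib-xor (f i) (g i)) (⊕-distrib-xor (λ i → ⊕[ f i ]) (λ i → ⊕[ g i ]))

⊕³-distrib-xor : ∀ {n} (f g : Fin n → Fin n → Fin n → Bool) →
  ⊕[ (λ i → ⊕[ (λ k → ⊕[ (λ j → f i k j xor g i k j) ]) ]) ] ≡
  ⊕[ (λ i → ⊕[ (λ k → ⊕[ f i k ]) ]) ] xor ⊕[ (λ i → ⊕[ (λ k → ⊕[ g i k ]) ]) ]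
⊕³-distrib-xor f g = trans (⊕-cong λ i → ⊕²-distrib-xor (f i) (g i))
  (⊕-distrib-xor (λ i → ⊕[ (λ k → ⊕[ f i k ]) ]) (λ i → ⊕[ (λ k → ⊕[ g i k ]) ]))

x-terms : ∀ {n} → Equation n → Assignment n → Fin n → Fin n → Bool
x-terms e σ i j = dist₂ i j ∧ (cx e i j ∧ x σ i j)

z-terms : ∀ {n} → Equation n → Assignment n → Fin n → Fin n → Fin n → Bool
z-terms e σ i k j = dist₃ i k j ∧ (cz e i k j ∧ z σ i k j)

x-sum : ∀ {n} → Equation n → Assignment n → Bool
x-sum e σ = ⊕[ (λ i → ⊕[ x-terms e σ i ]) ]

z-sum : ∀ {n} → Equation n → Assignment n → Bool
z-sum e σ = ⊕[ (λ i → ⊕[ (λ k → ⊕[ z-terms e σ i k ]) ]) ]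

lhs-⊕ₐ : ∀ {n} (e : Equation n) σ δ → lhs e (σ ⊕ₐ δ) ≡ lhs e σ xor lhs e δ
lhs-⊕ₐ e σ δ = begin
  x-sum e (σ ⊕ₐ δ) xor z-sum e (σ ⊕ₐ δ)               ≡⟨ cong₂ _xor_ x-split z-split ⟩
  (x-sum e σ xor x-sum e δ) xor (z-sum e σ xor z-sum e δ) ≡⟨ interchange (x-sum e σ) (x-sum e δ) (z-sum e σ) (z-sum e δ) ⟩
  (x-sum e σ xor z-sum e σ) xor (x-sum e δ xor z-sum e δ) ∎
  where
  open ≡-Reasoning
  x-split : x-sum e (σ ⊕ₐ δ) ≡ x-sum e σ xor x-sum e δ
  x-split = trans (⊕-cong λ i → ⊕-cong λ j → ∧∧-distribˡ-xor (dist₂ i j) (cx e i j) (x σ i j) (x δ i j))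
                  (⊕²-distrib-xor (x-terms e σ) (x-terms e δ))
  z-split : z-sum e (σ ⊕ₐ δ) ≡ z-sum e σ xor z-sum e δ
  z-split = trans (⊕-cong λ i → ⊕-cong λ k → ⊕-cong λ j → ∧∧-distribˡ-xor (dist₃ i k j) (cz e i k j) (z σ i k j) (z δ i k j))
                  (⊕³-distrib-xor (z-terms e σ) (z-terms e δ))

horn₁ : ∀ {a b} → (a ≡ true → b ≡ true) → a ≡ false ⊎ b ≡ true
horn₁ {false} _   = inj₁ refl
horn₁ {true}  a→b = inj₂ (a→b refl)

horn₂ : ∀ {a b c} → (a ≡ true → b ≡ true → c ≡ true) → a ≡ false ⊎ (b ≡ false ⊎ c ≡ true)
horn₂ {false} _     = inj₁ refl
horn₂ {true}  a→b→c = inj₂ (horn₁ (a→b→c refl))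

complement-clauses : ∀ {a b} → b ≡ not a → (a ≡ false ⊎ b ≡ false) × (a ≡ true ⊎ b ≡ true)
complement-clauses {false} refl = inj₁ refl , inj₂ refl
complement-clauses {true}  refl = inj₂ refl , inj₁ refl

module StrictOrder {n} {σ : Assignment n} (proper : WORDER-proper σ) where
  open WORDER-proper proper using (antisym; total) renaming (trans to transitive)

  x-complement : ∀ {i j} → i ≢ j → x σ j i ≡ not (x σ i j)
  x-complement {i} {j} i≢j with x σ i j | antisym i j i≢j | total i j i≢j
  ... | true  | inj₂ xji≡false | _              = xji≡false
  ... | false | _              | inj₂ xji≡true  = xji≡true

  _≺_ : Fin n → Fin n → Set
  i ≺ j = i ≢ j × x σ i j ≡ true

  ≺⇒x-false : ∀ {i j} → i ≺ j → x σ j i ≡ false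
  ≺⇒x-false (i≢j , xij) = trans (x-complement i≢j) (cong not xij)

  ≺-asym : ∀ {i j} → i ≺ j → ¬ j ≺ i
  ≺-asym i≺j (_ , xji) = contradiction (trans (sym xji) (≺⇒x-false i≺j)) λ ()

  x-trans : ∀ {i j k} → i ≢ j → j ≢ k → i ≢ k → x σ i j ≡ true → x σ j k ≡ true → x σ i k ≡ true
  x-trans {i} {j} {k} i≢j j≢k i≢k xij xjk with transitive i j k i≢j j≢k i≢k
  ... | inj₁ xij≡false          = contradiction (trans (sym xij) xij≡false) λ ()
  ... | inj₂ (inj₁ xjk≡false)   = contradiction (trans (sym xjk) xjk≡false) λ ()
  ... | inj₂ (inj₂ xik)         = xik

  ≺-trans : ∀ {i j k} → i ≺ j → j ≺ k → i ≺ k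
  ≺-trans {i} {j} {k} (i≢j , xij) (j≢k , xjk) = i≢k , x-trans i≢j j≢k i≢k xij xjk
    where
    i≢k : i ≢ k
    i≢k refl = ≺-asym (i≢j , xij) (j≢k , xjk)

  ≺-compare : ∀ {i j} → i ≢ j → i ≺ j ⊎ j ≺ i
  ≺-compare {i} {j} i≢j with x σ i j in xij
  ... | true  = inj₁ (i≢j , refl)
  ... | false = inj₂ ((λ j≡i → i≢j (sym j≡i)) , trans (x-complement i≢j) (cong not xij))

module Lexicographic (reversed : ℕ → Bool) where

  lex : ℕ → ℕ → Bool → Bool → Bool
  lex a b p q with <-cmp a b
  ... | tri< _ _ _ = true
  ... | tri≈ _ _ _ = if reversed a then q else p
  ... | tri> _ _ _ = false

  lex-< : ∀ {a b} → a < b → ∀ p q → lex a b p q ≡ true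
  lex-< {a} {b} a<b p q with <-cmp a b
  ... | tri< _ _ _    = refl
  ... | tri≈ ¬a<b _ _ = contradiction a<b ¬a<b
  ... | tri> ¬a<b _ _ = contradiction a<b ¬a<b

  lex-complement : ∀ a b p → lex b a (not p) p ≡ not (lex a b p (not p))
  lex-complement a b p with <-cmp a b | <-cmp b a
  ... | tri< _ _ _      | tri> _ _ _      = refl
  ... | tri> _ _ _      | tri< _ _ _      = refl
  ... | tri≈ _ refl _   | tri≈ _ _ _ with reversed a
  ...   | true  = sym (not-involutive p)
  ...   | false = refl
  lex-complement a b p | tri< a<b _ _ | tri< b<a _ _ = contradiction b<a (<-asym a<b)
  lex-complement a b p | tri< a<b _ _ | tri≈ _ refl _ = contradiction a<b (<-irrefl refl)
  lex-complement a b p | tri≈ _ refl _ | tri< b<a _ _ = contradiction b<a (<-irrefl refl)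
  lex-complement a b p | tri≈ _ refl _ | tri> _ _ a<b = contradiction a<b (<-irrefl refl)
  lex-complement a b p | tri> _ _ b<a | tri≈ _ refl _ = contradiction b<a (<-irrefl refl)
  lex-complement a b p | tri> _ _ b<a | tri> _ _ a<b = contradiction b<a (<-asym a<b)

  lex-trans : ∀ a b c {pij pji pjk pkj pik pki} →
    (pij ≡ true → pjk ≡ true → pik ≡ true) → (pkj ≡ true → pji ≡ true → pki ≡ true) →
    lex a b pij pji ≡ true → lex b c pjk pkj ≡ true → lex a c pik pki ≡ true
  lex-trans a b c t₁ t₂ h₁ h₂ with <-cmp a b | <-cmp b c | <-cmp a c
  ... | _             | _             | tri< _ _ _    = refl
  ... | tri> _ _ _    | _             | _             = contradiction h₁ λ ()
  ... | _             | tri> _ _ _    | _             = contradiction h₂ λ ()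
  ... | tri≈ _ refl _ | tri≈ _ refl _ | tri≈ _ _ _ with reversed a
  ...   | true  = t₂ h₂ h₁
  ...   | false = t₁ h₁ h₂
  lex-trans a b c _ _ _ _ | tri< a<b _ _ | tri< b<c _ _ | tri≈ _ refl _ = contradiction b<c (<-asym a<b)
  lex-trans a b c _ _ _ _ | tri< a<b _ _ | tri< b<c _ _ | tri> _ _ c<a  = contradiction c<a (<-asym (<-trans a<b b<c))
  lex-trans a b c _ _ _ _ | tri< a<b _ _ | tri≈ _ refl _ | tri≈ _ refl _ = contradiction a<b (<-irrefl refl)
  lex-trans a b c _ _ _ _ | tri< a<b _ _ | tri≈ _ refl _ | tri> _ _ c<a = contradiction c<a (<-asym a<b)
  lex-trans a b c _ _ _ _ | tri≈ _ refl _ | tri< b<c _ _ | tri≈ _ refl _ = contradiction b<c (<-irrefl refl)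
  lex-trans a b c _ _ _ _ | tri≈ _ refl _ | tri< b<c _ _ | tri> _ _ c<a = contradiction c<a (<-asym b<c)
  lex-trans a b c _ _ _ _ | tri≈ _ refl _ | tri≈ _ refl _ | tri> _ _ c<a = contradiction c<a (<-irrefl refl)

data Region : Set where
  before-s at-s between at-t after-t : Region

rank : Region → ℕ
rank before-s = 0
rank at-s     = 1
rank between  = 2
rank at-t     = 3
rank after-t  = 4

-- Keys of τ_c, in increasing order: unmoved elements below s, s, elements moved up from below s,
-- elements between s and t, elements moved down from above t, t, unmoved elements above t.
-- Inside the two moved blocks (keys 2 and 4) the σ-order is reversed.
reversed : ℕ → Bool
reversed 2 = true
reversed 4 = true
reversed _ = false

keyOf : Region → Bool → ℕ
keyOf before-s false = 0
keyOf at-s     _     = 1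
keyOf before-s true  = 2
keyOf between  _     = 3
keyOf after-t  true  = 4
keyOf at-t     _     = 5
keyOf after-t  false = 6

data Pick : Set where
  first second neither : Pick

select : Pick → Bool → Bool → Bool
select first   a b = a
select second  a b = b
select neither a b = false

select-xor : ∀ π a b a' b' → select π (a xor a') (b xor b') ≡ select π a b xor select π a' b'
select-xor first   _ _ _ _ = refl
select-xor second  _ _ _ _ = refl
select-xor neither _ _ _ _ = refl

pick : Region → Region → Bool → Pick
pick before-s before-s xij = if xij then first else second
pick before-s at-s     _   = first
pick at-s     before-s _   = second
pick after-t  after-t  xij = if xij then second else first
pick after-t  at-t     _   = first
pick at-t     after-t  _   = second
pick _        _        _   = neither

orient : Region → Region → Bool → Bool
orient ri rj xij = if rank ri <ᵇ rank rj then true else if rank rj <ᵇ rank ri then false else xij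

∀-bool? : ∀ {P : Bool → Set} → (∀ b → Dec (P b)) → Dec (∀ b → P b)
∀-bool? P? = map′ (λ (t , f) → λ { true → t ; false → f }) (λ h → h true , h false) (P? true ×-dec P? false)

∀-region? : ∀ {P : Region → Set} → (∀ r → Dec (P r)) → Dec (∀ r → P r)
∀-region? P? =
  map′ (λ (a , b , c , d , e) → λ { before-s → a ; at-s → b ; between → c ; at-t → d ; after-t → e })
       (λ h → h before-s , h at-s , h between , h at-t , h after-t)
       (P? before-s ×-dec P? at-s ×-dec P? between ×-dec P? at-t ×-dec P? after-t)

open Lexicographic reversed

KeyOrderFlip : Region → Region → Bool → Bool → Bool → Set
KeyOrderFlip ri rj ci cj xij = lex (keyOf ri ci) (keyOf rj cj) o (not o) ≡ o xor select (pick ri rj o) ci cj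
  where o = orient ri rj xij

key-order-flip? : ∀ ri rj ci cj xij → Dec (KeyOrderFlip ri rj ci cj xij)
key-order-flip? ri rj ci cj xij = _ ≟ᵇ _

key-order-flip : ∀ ri rj ci cj xij → KeyOrderFlip ri rj ci cj xij
key-order-flip = from-yes (∀-region? λ ri → ∀-region? λ rj → ∀-bool? λ ci → ∀-bool? λ cj → ∀-bool? (key-order-flip? ri rj ci cj))

module Reorder {n} {σ : Assignment n} (proper : WORDER-proper σ) (s t : Fin n) (s≢t : s ≢ t) (xst : x σ s t ≡ true) where
  open StrictOrder proper

  s≺t : s ≺ t
  s≺t = s≢t , xst

  data Position (k : Fin n) : Region → Set where
    before-s : k ≺ s → Position k before-s
    at-s     : k ≡ s → Position k at-s
    between  : s ≺ k → k ≺ t → Position k between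
    at-t     : k ≡ t → Position k at-t
    after-t  : t ≺ k → Position k after-t

  position : ∀ k → Σ Region (Position k)
  position k with k ≟ s | k ≟ t
  ... | yes k≡s | _       = at-s , at-s k≡s
  ... | no _    | yes k≡t = at-t , at-t k≡t
  ... | no k≢s  | no k≢t with ≺-compare k≢s
  ...   | inj₁ k≺s = before-s , before-s k≺s
  ...   | inj₂ s≺k with ≺-compare k≢t
  ...     | inj₁ k≺t = between , between s≺k k≺t
  ...     | inj₂ t≺k = after-t , after-t t≺k

  region : Fin n → Region
  region k = proj₁ (position k)

  precedes : ∀ {i j ri rj} → Position i ri → Position j rj → (rank ri <ᵇ rank rj) ≡ true → i ≺ j
  precedes (before-s i≺s) (before-s _)    ()
  precedes (before-s i≺s) (at-s refl)     _ = i≺s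
  precedes (before-s i≺s) (between s≺j _) _ = ≺-trans i≺s s≺j
  precedes (before-s i≺s) (at-t refl)     _ = ≺-trans i≺s s≺t
  precedes (before-s i≺s) (after-t t≺j)   _ = ≺-trans i≺s (≺-trans s≺t t≺j)
  precedes (at-s _)       (before-s _)    ()
  precedes (at-s _)       (at-s _)        ()
  precedes (at-s refl)    (between s≺j _) _ = s≺j
  precedes (at-s refl)    (at-t refl)     _ = s≺t
  precedes (at-s refl)    (after-t t≺j)   _ = ≺-trans s≺t t≺j
  precedes (between _ _)  (before-s _)    ()
  precedes (between _ _)  (at-s _)        ()
  precedes (between _ _)  (between _ _)   ()
  precedes (between _ i≺t) (at-t refl)    _ = i≺t
  precedes (between _ i≺t) (after-t t≺j)  _ = ≺-trans i≺t t≺j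
  precedes (at-t _)       (before-s _)    ()
  precedes (at-t _)       (at-s _)        ()
  precedes (at-t _)       (between _ _)   ()
  precedes (at-t _)       (at-t _)        ()
  precedes (at-t refl)    (after-t t≺j)   _ = t≺j
  precedes (after-t _)    (before-s _)    ()
  precedes (after-t _)    (at-s _)        ()
  precedes (after-t _)    (between _ _)   ()
  precedes (after-t _)    (at-t _)        ()
  precedes (after-t _)    (after-t _)     ()

  x-oriented : ∀ {i j} → orient (region i) (region j) (x σ i j) ≡ x σ i j
  x-oriented {i} {j} with rank (region i) <ᵇ rank (region j) in ri<rj
  ... | true = sym (proj₂ (precedes (proj₂ (position i)) (proj₂ (position j)) ri<rj))
  ... | false with rank (region j) <ᵇ rank (region i) in rj<ri
  ...   | true  = sym (≺⇒x-false (precedes (proj₂ (position j)) (proj₂ (position i)) rj<ri))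
  ...   | false = refl

  key : Bits n → Fin n → ℕ
  key c k = keyOf (region k) (c k)

  flip : Bits n → Fin n → Fin n → Bool
  flip c i j = select (pick (region i) (region j) (x σ i j)) (c i) (c j)

  change : Bits n → Assignment n
  x (change c) = flip c
  z (change c) i k j = ⌊ i ≟ s ⌋ ∧ (⌊ j ≟ t ⌋ ∧ c k)

  reorder : Bits n → Assignment n
  x (reorder c) i j = lex (key c i) (key c j) (x σ i j) (x σ j i)
  z (reorder c) = z (change c)

  reorder-x : ∀ c {i j} → i ≢ j → x (reorder c) i j ≡ x σ i j xor flip c i j
  reorder-x c {i} {j} i≢j = begin
    lex (key c i) (key c j) (x σ i j) (x σ j i)       ≡⟨ cong (lex (key c i) (key c j) (x σ i j)) (x-complement i≢j) ⟩
    lex (key c i) (key c j) (x σ i j) (not (x σ i j)) ≡⟨ subst agrees x-oriented (key-order-flip (region i) (region j) (c i) (c j) (x σ i j)) ⟩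
    x σ i j xor flip c i j                            ∎
    where
    open ≡-Reasoning
    agrees : Bool → Set
    agrees b = lex (key c i) (key c j) b (not b) ≡ b xor select (pick (region i) (region j) b) (c i) (c j)

  reorder-complement : ∀ c {i j} → i ≢ j → x (reorder c) j i ≡ not (x (reorder c) i j)
  reorder-complement c {i} {j} i≢j = begin
    lex (key c j) (key c i) (x σ j i) (x σ i j)             ≡⟨ cong (λ b → lex (key c j) (key c i) b (x σ i j)) (x-complement i≢j) ⟩
    lex (key c j) (key c i) (not (x σ i j)) (x σ i j)       ≡⟨ lex-complement (key c i) (key c j) (x σ i j) ⟩
    not (lex (key c i) (key c j) (x σ i j) (not (x σ i j))) ≡⟨ cong (λ b → not (lex (key c i) (key c j) (x σ i j) b)) (x-complement i≢j) ⟨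
    not (lex (key c i) (key c j) (x σ i j) (x σ j i))       ∎
    where open ≡-Reasoning

  key-s : ∀ c → key c s ≡ 1
  key-s c with position s
  ... | at-s , _                  = refl
  ... | before-s , before-s s≺s   = contradiction refl (proj₁ s≺s)
  ... | between , between s≺s _   = contradiction refl (proj₁ s≺s)
  ... | at-t , at-t s≡t           = contradiction s≡t s≢t
  ... | after-t , after-t t≺s     = contradiction t≺s (≺-asym s≺t)

  key-t : ∀ c → key c t ≡ 5
  key-t c with position t
  ... | at-t , _                  = refl
  ... | after-t , after-t t≺t     = contradiction refl (proj₁ t≺t)
  ... | between , between _ t≺t   = contradiction refl (proj₁ t≺t)
  ... | at-s , at-s t≡s           = contradiction (sym t≡s) s≢t
  ... | before-s , before-s t≺s   = contradiction t≺s (≺-asym s≺t)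

  moved-key : ∀ {c k} → c k ≡ true → k ≢ s → k ≢ t → T (1 <ᵇ key c k) × T (key c k <ᵇ 5)
  moved-key {c} {k} ck k≢s k≢t with position k
  ... | before-s , _    rewrite ck = tt , tt
  ... | at-s , at-s k≡s = contradiction k≡s k≢s
  ... | between , _     = tt , tt
  ... | at-t , at-t k≡t = contradiction k≡t k≢t
  ... | after-t , _     rewrite ck = tt , tt

  s-before-moved : ∀ {c k} → c k ≡ true → k ≢ s → k ≢ t → x (reorder c) s k ≡ true
  s-before-moved {c} {k} ck k≢s k≢t =
    lex-< (subst (_< key c k) (sym (key-s c)) (<ᵇ⇒< 1 (key c k) (proj₁ (moved-key {c} ck k≢s k≢t)))) _ _

  moved-before-t : ∀ {c k} → c k ≡ true → k ≢ s → k ≢ t → x (reorder c) k t ≡ true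
  moved-before-t {c} {k} ck k≢s k≢t =
    lex-< (subst (key c k <_) (sym (key-t c)) (<ᵇ⇒< (key c k) 5 (proj₂ (moved-key {c} ck k≢s k≢t)))) _ _

  change-z-shape : ∀ c {i k j} → z (change c) i k j ≡ true → i ≡ s × j ≡ t × c k ≡ true
  change-z-shape c {i} {k} {j} zikj with i ≟ s | j ≟ t
  ... | yes i≡s | yes j≡t = i≡s , j≡t , zikj

  change-z-skt : ∀ c k → z (change c) s k t ≡ c k
  change-z-skt c k = cong₂ (λ a b → a ∧ (b ∧ c k)) (isYes-true (s ≟ s) refl) (isYes-true (t ≟ t) refl)

  reorder-proper : ∀ c → WORDER-proper (reorder c)
  reorder-proper c = record
    { antisym = λ i j i≢j → proj₁ (complement-clauses (reorder-complement c i≢j))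
    ; total   = λ i j i≢j → proj₂ (complement-clauses (reorder-complement c i≢j))
    ; trans   = λ i j k i≢j j≢k i≢k → horn₂ (lex-trans (key c i) (key c j) (key c k)
                  (x-trans i≢j j≢k i≢k) (x-trans (≢-sym j≢k) (≢-sym i≢j) (≢-sym i≢k)))
    ; zleft   = λ i k j i≢k k≢j i≢j → horn₁ λ zikj → zleft′ (change-z-shape c zikj) i≢k k≢j
    ; zright  = λ i k j i≢k k≢j i≢j → horn₁ λ zikj → zright′ (change-z-shape c zikj) i≢k k≢j
    }
    where
    zleft′ : ∀ {i k j} → i ≡ s × j ≡ t × c k ≡ true → i ≢ k → k ≢ j → x (reorder c) i k ≡ true
    zleft′ (refl , refl , ck) s≢k k≢t = s-before-moved {c} ck (≢-sym s≢k) k≢t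
    zright′ : ∀ {i k j} → i ≡ s × j ≡ t × c k ≡ true → i ≢ k → k ≢ j → x (reorder c) k j ≡ true
    zright′ (refl , refl , ck) s≢k k≢t = moved-before-t {c} ck (≢-sym s≢k) k≢t

  change-⊕ : ∀ c d → change (c ⊕ d) ≐ change c ⊕ₐ change d
  change-⊕ c d = (λ {i j} _ → select-xor (pick (region i) (region j) (x σ i j)) (c i) (c j) (d i) (d j))
               , (λ {i k j} _ _ _ → ∧∧-distribˡ-xor ⌊ i ≟ s ⌋ ⌊ j ≟ t ⌋ (c k) (d k))

  change-resp : ∀ {c d} → c ≗ d → change c ≐ change d
  change-resp c≗d = (λ {i j} _ → cong₂ (select (pick (region i) (region j) (x σ i j))) (c≗d i) (c≗d j))
                  , (λ {i k j} _ _ _ → cong (λ b → ⌊ i ≟ s ⌋ ∧ (⌊ j ≟ t ⌋ ∧ b)) (c≗d k))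

  change-linear : ∀ e → Linear (lhs e ∘ change)
  change-linear e = record
    { additive = λ c d → trans (lhs-resp e (change-⊕ c d)) (lhs-⊕ₐ e (change c) (change d))
    ; resp-≗   = λ c≗d → lhs-resp e (change-resp c≗d)
    }

  outside-s-t : Bits n
  outside-s-t = ((λ _ → true) - s) - t

  count-outside-s-t : 2 + count outside-s-t ≡ n
  count-outside-s-t = begin
    suc (suc (count outside-s-t))       ≡⟨ cong suc (count-remove ((λ _ → true) - s) t≠s) ⟨
    suc (count ((λ _ → true) - s))      ≡⟨ count-remove {n} (λ _ → true) {s} refl ⟨
    count {n} (λ _ → true)              ≡⟨ count-all n ⟩
    n                                   ∎
    where
    open ≡-Reasoning
    t≠s : ((λ _ → true) - s) t ≡ true
    t≠s = cong not (isYes-false (t ≟ s) (≢-sym s≢t))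

  fewer-equations-than-outside-s-t : ∀ (A : LinSystem n) → length A + 3 ≤ n → length A < count outside-s-t
  fewer-equations-than-outside-s-t A |A|+3≤n =
    s≤s⁻¹ (s≤s⁻¹ (subst₂ _≤_ (+-comm (length A) 3) (sym count-outside-s-t) |A|+3≤n))

  outside-s-t-avoids : ∀ {k} → outside-s-t k ≡ true → k ≢ s × k ≢ t
  outside-s-t-avoids {k} k∈Q with remove⁻ ((λ _ → true) - s) k∈Q
  ... | k∈Q′ , k≢t = proj₂ (remove⁻ (λ _ → true) k∈Q′) , k≢t

  module _ (zσ≡false : ∀ i k j → i ≢ k → k ≢ j → i ≢ j → z σ i k j ≡ false) where

    reorder≐σ⊕change : ∀ c → reorder c ≐ σ ⊕ₐ change c
    reorder≐σ⊕change c = reorder-x c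
                       , (λ {i k j} i≢k k≢j i≢j → cong (_xor z (change c) i k j) (sym (zσ≡false i k j i≢k k≢j i≢j)))

    reorder-solves : ∀ c (A : LinSystem n) → All (λ e → lhs e (change c) ≡ false) A → Solves σ A → Solves (reorder c) A
    reorder-solves c A ker σ-solves = All.zipWith shifted (ker , σ-solves)
      where
      shifted : ∀ {e} → lhs e (change c) ≡ false × lhs e σ ≡ rhs e → lhs e (reorder c) ≡ rhs e
      shifted {e} (Λc≡false , σ-solves-e) = begin
        lhs e (reorder c)                  ≡⟨ lhs-resp e (reorder≐σ⊕change c) ⟩
        lhs e (σ ⊕ₐ change c)              ≡⟨ lhs-⊕ₐ e σ (change c) ⟩
        lhs e σ xor lhs e (change c)       ≡⟨ cong₂ _xor_ σ-solves-e Λc≡false ⟩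
        rhs e xor false                    ≡⟨ xor-identityʳ (rhs e) ⟩
        rhs e                              ∎
        where open ≡-Reasoning

    dense-reordering : ∀ (A : LinSystem n) → length A + 3 ≤ n → Solves σ A →
      ∃[ τ ] (WORDER-proper τ × Solves τ A × SatDensity τ s t ×
        (∀ i k j → i ≢ k → k ≢ j → i ≢ j → z τ i k j ≡ true → i ≡ s × j ≡ t))
    dense-reordering A |A|+3≤n σ-solves with common-zero (λ e → lhs e ∘ change) change-linear A outside-s-t
                                                 (fewer-equations-than-outside-s-t A |A|+3≤n)
    ... | c , (k , ck) , c⊆Q , ker =
      reorder c , reorder-proper c , reorder-solves c A ker σ-solves ,
      inj₂ (k , k≢s , k≢t , trans (change-z-skt c k) ck) ,
      λ i k j _ _ _ zikj → let (i≡s , j≡t , _) = change-z-shape c zikj in i≡s , j≡t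
      where
      k≢s : k ≢ s
      k≢s = proj₁ (outside-s-t-avoids (c⊆Q k ck))
      k≢t : k ≢ t
      k≢t = proj₂ (outside-s-t-avoids (c⊆Q k ck))

proposition3p8 : ∀ n (A : LinSystem n) → length A + 3 ≤ n →
    (σ : Assignment n) → Solves σ A → WORDER-proper σ →
    (∀ i k j → i ≢ k → k ≢ j → i ≢ j → z σ i k j ≡ false) →
    ∀ (s t : Fin n) → s ≢ t →
    ∃[ τ ] (WORDER-proper τ × Solves τ A × SatDensity τ s t ×
      (∀ i k j → i ≢ k → k ≢ j → i ≢ j → z τ i k j ≡ true → i ≡ s × j ≡ t))
proposition3p8 n A |A|+3≤n σ σ-solves proper zσ≡false s t s≢t with x σ s t in xst
... | false = σ , proper , σ-solves , inj₁ xst ,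
              λ i k j i≢k k≢j i≢j zσ≡true → contradiction (trans (sym zσ≡true) (zσ≡false i k j i≢k k≢j i≢j)) λ ()
... | true  = Reorder.dense-reordering proper s t s≢t xst zσ≡false A |A|+3≤n σ-solves
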